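{- Let $p_0(x)=1$ and $p_n(x)=x(x-1)^{n-1}$ for $n\geq 1$. Let $n,m\geq 1$. Then: (1) $p_n(x)\,p_m(x)=x\,p_{n+m-1}(x)$; (2) for every $k\in\mathbb{N}$, $x^k p_n(x)=\sum_{h=0}^{k}\binom{k}{h}p_{n+h}(x)$; in particular $x\,p_n(x)=p_{n+1}(x)+p_n(x)$; (3) let $\mathbf{x}^{ -1}$ be the linear operator on $\mathbb{R}[x]$ defined by $\mathbf{x}^{ -1}(p(x))=\frac{p(x)-p(0)}{x}$, and $\mathbf{x}^{ -k}$ its $k$-th iterate. Then for every $k\geq 1$, \[ \mathbf{x}^{ -k}p_n(x)=\sum_{h=0}^{n-k}(-1)^{n-k-h}\binom{n-1-h}{k-1}p_h(x); \] in particular $\mathbf{x}^{ -1}p_n(x)=\sum_{h=0}^{n-1}(-1)^{n-h-1}p_h(x)=p_{n-1}(x)-p_{n-2}(x)+p_{n-3}(x)-\cdots$.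
   Context: $\mathbb{N}=\{0,1,2,\dots\}$. The polynomials $p_n$ form the so-called Aigner basis of $\mathbb{R}[x]$. An empty sum is $0$. -}

module Defs where

open import Data.Nat as ℕ using (ℕ; zero; suc; _∸_)
open import Data.Nat.Combinatorics using (_C_)
open import Data.Integer as ℤ using (ℤ; +_; 0ℤ; 1ℤ; -1ℤ)

-- Polynomials are represented by their coefficient sequences:
-- f i is the coefficient of x^i.  Equality is coefficientwise.
Poly : Set
Poly = ℕ → ℤ

infix 4 _≈P_
_≈P_ : Poly → Poly → Set
f ≈P g = ∀ i → f i ≡ g i
  where open import Relation.Binary.PropositionalEquality using (_≡_)

sumℤ : ℕ → (ℕ → ℤ) → ℤ
sumℤ zero    a = 0ℤ
sumℤ (suc n) a = sumℤ n a ℤ.+ a n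

constP : ℤ → Poly
constP c zero    = c
constP c (suc i) = 0ℤ

X : Poly
X 1 = 1ℤ
X _ = 0ℤ

infixl 6 _+P_ _-P_
infixl 7 _*P_ _·P_

_+P_ : Poly → Poly → Poly
(f +P g) i = f i ℤ.+ g i

_-P_ : Poly → Poly → Poly
(f -P g) i = f i ℤ.- g i

_·P_ : ℤ → Poly → Poly
(c ·P f) i = c ℤ.* f i

_*P_ : Poly → Poly → Poly
(f *P g) i = sumℤ (suc i) (λ j → f j ℤ.* g (i ∸ j))

_^P_ : Poly → ℕ → Poly
f ^P zero  = constP 1ℤ
f ^P suc n = f *P (f ^P n)

ΣP : ℕ → (ℕ → Poly) → Poly
ΣP zero    F = constP 0ℤ
ΣP (suc n) F = ΣP n F +P F n

p : ℕ → Poly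
p zero    = constP 1ℤ
p (suc n) = X *P ((X -P constP 1ℤ) ^P n)

-- the operator x^{-1} : p(x) ↦ (p(x) - p(0)) / x, which on coefficient
-- sequences is exactly the shift  (a_0, a_1, a_2, …) ↦ (a_1, a_2, …)
xInv : Poly → Poly
xInv f i = f (suc i)

xInvPow : ℕ → Poly → Poly
xInvPow zero    f = f
xInvPow (suc k) f = xInv (xInvPow k f)

binom : ℕ → ℕ → ℤ
binom a b = + (a C b)

{-# OPTIONS --safe #-}
-- On coefficient sequences, multiplication by x is the shift and multiplication by x - 1 is
-- f ↦ shift f - f.  Hence p (n+1) = shift ((x-1)^n) and p (n+2) = (x-1) p (n+1), that is
-- x p n = p (n+1) + p n, which Pascal's rule iterates to (2).  Part (1) reduces to
-- (x-1)^a (x-1)^b = (x-1)^(a+b), proved by induction on a using only the description of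
-- multiplication by x - 1, so associativity of the Cauchy product is never needed.  Since x^{-1}
-- undoes the shift, x^{-1} p (n+1) = (x-1)^n, whose expansion in the p h is alternating; and
-- applying x^{-(k+1)} to p (n+2) = shift (p (n+1)) - p (n+1) shows that the coefficient of p h in
-- x^{-(k+1)} p (n+1), namely (-1)^(r-k) C(r,k) with r = n - h, satisfies Pascal's rule in (r,k).
module Submission where

open import Defs
open import Data.Nat using (ℕ; zero; suc; _+_; _∸_; _≤_; _<_; z≤n; s≤s; _<?_)
import Data.Nat.Properties as ℕ
open import Data.Nat.Combinatorics using (_C_; nCk+nC[k+1]≡[n+1]C[k+1]; k>n⇒nCk≡0)
open import Data.Integer using (ℤ; +_; 0ℤ; 1ℤ; -1ℤ; -_; _^_; _*_)
  renaming (_+_ to _+ℤ_; _-_ to _-ℤ_)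
import Data.Integer.Properties as ℤ
open import Data.Integer.Tactic.RingSolver using (solve-∀)
open import Algebra.Properties.CommutativeSemigroup ℤ.+-commutativeSemigroup
  using (interchange; x∙yz≈y∙xz)
open import Algebra.Properties.Ring ℤ.+-*-ring using ([y-z]x≈yx-zx)
open import Data.Product using (_×_; _,_)
open import Data.Sum using (inj₁; inj₂)
open import Function using (_∘_)
open import Relation.Nullary using (yes; no)
open import Relation.Binary.PropositionalEquality
import Relation.Binary.Reasoning.Setoid as SetoidReasoning

module ≈P-Reasoning = SetoidReasoning (ℕ →-setoid ℤ)

sumℤ-cong : ∀ n {a b : ℕ → ℤ} → (∀ j → j < n → a j ≡ b j) → sumℤ n a ≡ sumℤ n b
sumℤ-cong zero    a≡b = refl
sumℤ-cong (suc n) a≡b =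
  cong₂ _+ℤ_ (sumℤ-cong n (λ j j<n → a≡b j (ℕ.m<n⇒m<1+n j<n))) (a≡b n ℕ.≤-refl)

sumℤ-zero : ∀ n → sumℤ n (λ _ → 0ℤ) ≡ 0ℤ
sumℤ-zero zero    = refl
sumℤ-zero (suc n) = cong (_+ℤ 0ℤ) (sumℤ-zero n)

sumℤ-head : ∀ n (a : ℕ → ℤ) → sumℤ (suc n) a ≡ a 0 +ℤ sumℤ n (a ∘ suc)
sumℤ-head zero    a = ℤ.+-comm 0ℤ (a 0)
sumℤ-head (suc n) a = trans (cong (_+ℤ a (suc n)) (sumℤ-head n a)) (ℤ.+-assoc (a 0) _ _)

sumℤ-+ : ∀ n (a b : ℕ → ℤ) → sumℤ n (λ j → a j +ℤ b j) ≡ sumℤ n a +ℤ sumℤ n b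
sumℤ-+ zero    a b = refl
sumℤ-+ (suc n) a b =
  trans (cong (_+ℤ (a n +ℤ b n)) (sumℤ-+ n a b)) (interchange (sumℤ n a) (sumℤ n b) (a n) (b n))

sumℤ-neg : ∀ n (a : ℕ → ℤ) → sumℤ n (λ j → - a j) ≡ - sumℤ n a
sumℤ-neg zero    a = refl
sumℤ-neg (suc n) a =
  trans (cong (_+ℤ - a n) (sumℤ-neg n a)) (sym (ℤ.neg-distrib-+ (sumℤ n a) (a n)))

sumℤ-- : ∀ n (a b : ℕ → ℤ) → sumℤ n (λ j → a j -ℤ b j) ≡ sumℤ n a -ℤ sumℤ n b
sumℤ-- n a b = trans (sumℤ-+ n a (λ j → - b j)) (cong (sumℤ n a +ℤ_) (sumℤ-neg n b))

sumℤ-trailing-zeros : ∀ {m} n (a : ℕ → ℤ) → m ≤ n →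
  (∀ j → m ≤ j → j < n → a j ≡ 0ℤ) → sumℤ n a ≡ sumℤ m a
sumℤ-trailing-zeros zero    a z≤n   _   = refl
sumℤ-trailing-zeros {m} (suc n) a m≤1+n a≡0 with ℕ.m≤n⇒m<n∨m≡n m≤1+n
... | inj₂ refl        = refl
... | inj₁ (s≤s m≤n) = begin
    sumℤ n a +ℤ a n  ≡⟨ cong₂ _+ℤ_ (sumℤ-trailing-zeros n a m≤n a≡0ʳ) (a≡0 n m≤n ℕ.≤-refl) ⟩
    sumℤ m a +ℤ 0ℤ   ≡⟨ ℤ.+-identityʳ _ ⟩
    sumℤ m a         ∎
  where
  open ≡-Reasoning
  a≡0ʳ : ∀ j → m ≤ j → j < n → a j ≡ 0ℤ
  a≡0ʳ j m≤j j<n = a≡0 j m≤j (ℕ.m<n⇒m<1+n j<n)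

binom-pascal : ∀ n k → binom (suc n) (suc k) ≡ binom n k +ℤ binom n (suc k)
binom-pascal n k =
  trans (cong +_ (sym (nCk+nC[k+1]≡[n+1]C[k+1] n k))) (ℤ.pos-+ (n C k) (n C suc k))

k>n⇒binom≡0 : ∀ {n k} → n < k → binom n k ≡ 0ℤ
k>n⇒binom≡0 n<k = cong +_ (k>n⇒nCk≡0 n<k)

sumℤ-binomial-pascal : ∀ k (c : ℕ → ℤ) →
  sumℤ (suc k) (λ h → binom k h * (c (suc h) +ℤ c h))
    ≡ sumℤ (suc (suc k)) (λ h → binom (suc k) h * c h)
sumℤ-binomial-pascal k c = begin
    sumℤ (suc k) (λ h → binom k h * (c (suc h) +ℤ c h))
  ≡⟨ sumℤ-cong (suc k) (λ h _ → ℤ.*-distribˡ-+ (binom k h) (c (suc h)) (c h)) ⟩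
    sumℤ (suc k) (λ h → binom k h * c (suc h) +ℤ binom k h * c h)
  ≡⟨ sumℤ-+ (suc k) _ _ ⟩
    A +ℤ sumℤ (suc k) (λ h → binom k h * c h)
  ≡⟨ cong (A +ℤ_) (sumℤ-head k _) ⟩
    A +ℤ (1ℤ * c 0 +ℤ B)
  ≡⟨ x∙yz≈y∙xz A (1ℤ * c 0) B ⟩
    1ℤ * c 0 +ℤ (A +ℤ B)
  ≡⟨ cong (1ℤ * c 0 +ℤ_) A+B ⟩
    1ℤ * c 0 +ℤ sumℤ (suc k) (λ h → binom (suc k) (suc h) * c (suc h))
  ≡⟨ sumℤ-head (suc k) _ ⟨
    sumℤ (suc (suc k)) (λ h → binom (suc k) h * c h)
  ∎
  where
  open ≡-Reasoning
  A B : ℤ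
  A = sumℤ (suc k) (λ h → binom k h * c (suc h))
  B = sumℤ k (λ h → binom k (suc h) * c (suc h))
  A+B : A +ℤ B ≡ sumℤ (suc k) (λ h → binom (suc k) (suc h) * c (suc h))
  A+B = begin
      A +ℤ B
    ≡⟨ cong (A +ℤ_) (trans (cong (λ z → B +ℤ z * c (suc k)) (k>n⇒binom≡0 {k} ℕ.≤-refl))
                           (ℤ.+-identityʳ B)) ⟨
      A +ℤ sumℤ (suc k) (λ h → binom k (suc h) * c (suc h))
    ≡⟨ sumℤ-+ (suc k) _ _ ⟨
      sumℤ (suc k) (λ h → binom k h * c (suc h) +ℤ binom k (suc h) * c (suc h))
    ≡⟨ sumℤ-cong (suc k) (λ h _ → trans (cong (_* c (suc h)) (binom-pascal k h))
                                      (ℤ.*-distribʳ-+ (c (suc h)) (binom k h) (binom k (suc h)))) ⟨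
      sumℤ (suc k) (λ h → binom (suc k) (suc h) * c (suc h))
    ∎

-1^-∸-suc : ∀ {m n} → n < m → -1ℤ ^ (m ∸ n) ≡ - (-1ℤ ^ (m ∸ suc n))
-1^-∸-suc {suc m} {zero}  _         = ℤ.-1*i≡-i (-1ℤ ^ m)
-1^-∸-suc {suc m} {suc n} (s≤s n<m) = -1^-∸-suc n<m

m∸n∸o≡m∸o∸n : ∀ m n o → m ∸ n ∸ o ≡ m ∸ o ∸ n
m∸n∸o≡m∸o∸n m n o =
  trans (ℕ.∸-+-assoc m n o) (trans (cong (m ∸_) (ℕ.+-comm n o)) (sym (ℕ.∸-+-assoc m o n)))

1+n∸k≤h⇒n∸h<k : ∀ {n k h} → suc n ∸ k ≤ h → h ≤ n → n ∸ h < k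
1+n∸k≤h⇒n∸h<k {n} {k} {h} 1+n∸k≤h h≤n = subst (_≤ k) (ℕ.+-∸-assoc 1 h≤n)
  (ℕ.m≤n+o⇒m∸n≤o (suc n) h (begin
    suc n             ≤⟨ ℕ.m≤n+m∸n (suc n) k ⟩
    k + (suc n ∸ k)   ≤⟨ ℕ.+-monoʳ-≤ k 1+n∸k≤h ⟩
    k + h             ≡⟨ ℕ.+-comm k h ⟩
    h + k             ∎))
  where open ℕ.≤-Reasoning

signedBinom : ℕ → ℕ → ℤ
signedBinom r k = -1ℤ ^ (r ∸ k) * binom r k

signedBinom-pascal : ∀ r k →
  signedBinom r k -ℤ signedBinom r (suc k) ≡ signedBinom (suc r) (suc k)
signedBinom-pascal r k = begin
    s * binom r k -ℤ -1ℤ ^ (r ∸ suc k) * binom r (suc k)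
  ≡⟨ cong (s * binom r k +ℤ_) flip ⟩
    s * binom r k +ℤ s * binom r (suc k)
  ≡⟨ ℤ.*-distribˡ-+ s (binom r k) (binom r (suc k)) ⟨
    s * (binom r k +ℤ binom r (suc k))
  ≡⟨ cong (s *_) (binom-pascal r k) ⟨
    s * binom (suc r) (suc k)
  ∎
  where
  open ≡-Reasoning
  s : ℤ
  s = -1ℤ ^ (r ∸ k)
  vanish : ∀ x → r ≤ k → x * binom r (suc k) ≡ 0ℤ
  vanish x r≤k = trans (cong (x *_) (k>n⇒binom≡0 (s≤s r≤k))) (ℤ.*-zeroʳ x)
  flip : - (-1ℤ ^ (r ∸ suc k) * binom r (suc k)) ≡ s * binom r (suc k)
  flip with k <? r
  ... | yes k<r = trans (ℤ.neg-distribˡ-* (-1ℤ ^ (r ∸ suc k)) (binom r (suc k)))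
                        (cong (_* binom r (suc k)) (sym (-1^-∸-suc k<r)))
  ... | no  k≮r = trans (cong -_ (vanish (-1ℤ ^ (r ∸ suc k)) (ℕ.≮⇒≥ k≮r)))
                        (sym (vanish s (ℕ.≮⇒≥ k≮r)))

+P-cong : ∀ {f f′ g g′} → f ≈P f′ → g ≈P g′ → f +P g ≈P f′ +P g′
+P-cong f≈f′ g≈g′ i = cong₂ _+ℤ_ (f≈f′ i) (g≈g′ i)

-P-cong : ∀ {f f′ g g′} → f ≈P f′ → g ≈P g′ → f -P g ≈P f′ -P g′
-P-cong f≈f′ g≈g′ i = cong₂ _-ℤ_ (f≈f′ i) (g≈g′ i)

ΣP-pointwise : ∀ n F i → ΣP n F i ≡ sumℤ n (λ h → F h i)
ΣP-pointwise zero    F zero    = refl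
ΣP-pointwise zero    F (suc i) = refl
ΣP-pointwise (suc n) F i       = cong (_+ℤ F n i) (ΣP-pointwise n F i)

ΣP-one : ∀ F → ΣP 1 F ≈P F 0
ΣP-one F i = trans (ΣP-pointwise 1 F i) (ℤ.+-identityˡ (F 0 i))

ΣP-cong : ∀ n {F G : ℕ → Poly} → (∀ h → h < n → F h ≈P G h) → ΣP n F ≈P ΣP n G
ΣP-cong zero    F≈G i = refl
ΣP-cong (suc n) F≈G i =
  cong₂ _+ℤ_ (ΣP-cong n (λ h h<n → F≈G h (ℕ.m<n⇒m<1+n h<n)) i) (F≈G n ℕ.≤-refl i)

ΣP-·P-sub : ∀ n (c d : ℕ → ℤ) (F : ℕ → Poly) →
  ΣP n (λ h → c h ·P F h) -P ΣP n (λ h → d h ·P F h) ≈P ΣP n (λ h → (c h -ℤ d h) ·P F h)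
ΣP-·P-sub n c d F i = begin
    ΣP n (λ h → c h ·P F h) i -ℤ ΣP n (λ h → d h ·P F h) i
  ≡⟨ cong₂ _-ℤ_ (ΣP-pointwise n _ i) (ΣP-pointwise n _ i) ⟩
    sumℤ n (λ h → c h * F h i) -ℤ sumℤ n (λ h → d h * F h i)
  ≡⟨ sumℤ-- n _ _ ⟨
    sumℤ n (λ h → c h * F h i -ℤ d h * F h i)
  ≡⟨ sumℤ-cong n (λ h _ → [y-z]x≈yx-zx (F h i) (c h) (d h)) ⟨
    sumℤ n (λ h → (c h -ℤ d h) * F h i)
  ≡⟨ ΣP-pointwise n _ i ⟨
    ΣP n (λ h → (c h -ℤ d h) ·P F h) i
  ∎
  where open ≡-Reasoning

ΣP-trailing-zeros : ∀ {m} n (F : ℕ → Poly) → m ≤ n →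
  (∀ h → m ≤ h → h < n → ∀ i → F h i ≡ 0ℤ) → ΣP n F ≈P ΣP m F
ΣP-trailing-zeros {m} n F m≤n F≡0 i = begin
    ΣP n F i                 ≡⟨ ΣP-pointwise n F i ⟩
    sumℤ n (λ h → F h i)     ≡⟨ sumℤ-trailing-zeros n _ m≤n (λ h m≤h h<n → F≡0 h m≤h h<n i) ⟩
    sumℤ m (λ h → F h i)     ≡⟨ ΣP-pointwise m F i ⟨
    ΣP m F i                 ∎
  where open ≡-Reasoning

ΣP-binomial-pascal : ∀ k (q : ℕ → Poly) →
  ΣP (suc k) (λ h → binom k h ·P (q (suc h) +P q h))
    ≈P ΣP (suc (suc k)) (λ h → binom (suc k) h ·P q h)
ΣP-binomial-pascal k q i =
  trans (ΣP-pointwise (suc k) _ i)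
        (trans (sumℤ-binomial-pascal k (λ h → q h i)) (sym (ΣP-pointwise (suc (suc k)) _ i)))

shift : Poly → Poly
shift f zero    = 0ℤ
shift f (suc i) = f i

shift-cong : ∀ {f g} → f ≈P g → shift f ≈P shift g
shift-cong f≈g zero    = refl
shift-cong f≈g (suc i) = f≈g i

shift-+P : ∀ f g → shift (f +P g) ≈P shift f +P shift g
shift-+P f g zero    = refl
shift-+P f g (suc i) = refl

shift--P : ∀ f g → shift (f -P g) ≈P shift f -P shift g
shift--P f g zero    = refl
shift--P f g (suc i) = refl

shift-·P : ∀ c f → shift (c ·P f) ≈P c ·P shift f
shift-·P c f zero    = sym (ℤ.*-zeroʳ c)
shift-·P c f (suc i) = refl

shift-ΣP : ∀ n F → shift (ΣP n F) ≈P ΣP n (shift ∘ F)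
shift-ΣP zero    F zero          = refl
shift-ΣP zero    F (suc zero)    = refl
shift-ΣP zero    F (suc (suc i)) = refl
shift-ΣP (suc n) F i =
  trans (shift-+P (ΣP n F) (F n) i) (cong (_+ℤ shift (F n) i) (shift-ΣP n F i))

*P-congˡ : ∀ {f g} h → f ≈P g → f *P h ≈P g *P h
*P-congˡ h f≈g i = sumℤ-cong (suc i) (λ j _ → cong (_* h (i ∸ j)) (f≈g j))

*P-congʳ : ∀ f {g h} → g ≈P h → f *P g ≈P f *P h
*P-congʳ f g≈h i = sumℤ-cong (suc i) (λ j _ → cong (f j *_) (g≈h (i ∸ j)))

*P-identityˡ : ∀ f → constP 1ℤ *P f ≈P f
*P-identityˡ f i = begin
    sumℤ (suc i) (λ j → constP 1ℤ j * f (i ∸ j))  ≡⟨ sumℤ-head i _ ⟩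
    1ℤ * f i +ℤ sumℤ i (λ _ → 0ℤ)                ≡⟨ cong₂ _+ℤ_ (ℤ.*-identityˡ (f i)) (sumℤ-zero i) ⟩
    f i +ℤ 0ℤ                                     ≡⟨ ℤ.+-identityʳ (f i) ⟩
    f i                                           ∎
  where open ≡-Reasoning

*P-distribʳ--P : ∀ f g h → (f -P g) *P h ≈P f *P h -P g *P h
*P-distribʳ--P f g h i =
  trans (sumℤ-cong (suc i) (λ j _ → [y-z]x≈yx-zx (h (i ∸ j)) (f j) (g j))) (sumℤ-- (suc i) _ _)

shift-*P : ∀ f g → shift f *P g ≈P shift (f *P g)
shift-*P f g zero    = refl
shift-*P f g (suc i) = trans (sumℤ-head (suc i) _) (ℤ.+-identityˡ _)

*P-shift : ∀ f g → f *P shift g ≈P shift (f *P g)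
*P-shift f g zero    = trans (ℤ.+-identityˡ _) (ℤ.*-zeroʳ (f 0))
*P-shift f g (suc i) = begin
    sumℤ (suc i) (λ j → f j * shift g (suc i ∸ j)) +ℤ f (suc i) * shift g (i ∸ i)
  ≡⟨ cong₂ _+ℤ_ (sumℤ-cong (suc i) (λ j j<1+i → cong (λ m → f j * shift g m)
                                                   (ℕ.+-∸-assoc 1 (ℕ.≤-pred j<1+i))))
                (cong (λ m → f (suc i) * shift g m) (ℕ.n∸n≡0 i)) ⟩
    sumℤ (suc i) (λ j → f j * g (i ∸ j)) +ℤ f (suc i) * 0ℤ
  ≡⟨ cong (sumℤ (suc i) (λ j → f j * g (i ∸ j)) +ℤ_) (ℤ.*-zeroʳ (f (suc i))) ⟩
    sumℤ (suc i) (λ j → f j * g (i ∸ j)) +ℤ 0ℤ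
  ≡⟨ ℤ.+-identityʳ _ ⟩
    sumℤ (suc i) (λ j → f j * g (i ∸ j))
  ∎
  where open ≡-Reasoning

X≈shift1 : X ≈P shift (constP 1ℤ)
X≈shift1 zero          = refl
X≈shift1 (suc zero)    = refl
X≈shift1 (suc (suc i)) = refl

X-*P : ∀ f → X *P f ≈P shift f
X-*P f i = begin
    (X *P f) i                    ≡⟨ *P-congˡ f X≈shift1 i ⟩
    (shift (constP 1ℤ) *P f) i    ≡⟨ shift-*P (constP 1ℤ) f i ⟩
    shift (constP 1ℤ *P f) i      ≡⟨ shift-cong (*P-identityˡ f) i ⟩
    shift f i                     ∎
  where open ≡-Reasoning

X^-*P-binomial : (q : ℕ → Poly) → (∀ h → X *P q h ≈P q (suc h) +P q h) →
  ∀ k → (X ^P k) *P q 0 ≈P ΣP (suc k) (λ h → binom k h ·P q h)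
X^-*P-binomial q X-*P-q zero i =
  trans (*P-identityˡ (q 0) i)
        (sym (trans (ΣP-one (λ h → binom 0 h ·P q h) i) (ℤ.*-identityˡ (q 0 i))))
X^-*P-binomial q X-*P-q (suc k) = begin
    (X *P X ^P k) *P q 0
  ≈⟨ *P-congˡ (q 0) (X-*P (X ^P k)) ⟩
    shift (X ^P k) *P q 0
  ≈⟨ shift-*P (X ^P k) (q 0) ⟩
    shift (X ^P k *P q 0)
  ≈⟨ shift-cong (X^-*P-binomial q X-*P-q k) ⟩
    shift (ΣP (suc k) (λ h → binom k h ·P q h))
  ≈⟨ shift-ΣP (suc k) (λ h → binom k h ·P q h) ⟩
    ΣP (suc k) (λ h → shift (binom k h ·P q h))
  ≈⟨ ΣP-cong (suc k) (λ h _ i → trans (shift-·P (binom k h) (q h) i)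
                                       (cong (binom k h *_) (shift-q h i))) ⟩
    ΣP (suc k) (λ h → binom k h ·P (q (suc h) +P q h))
  ≈⟨ ΣP-binomial-pascal k q ⟩
    ΣP (suc (suc k)) (λ h → binom (suc k) h ·P q h)
  ∎
  where
  open ≈P-Reasoning
  shift-q : ∀ h → shift (q h) ≈P q (suc h) +P q h
  shift-q h i = trans (sym (X-*P (q h) i)) (X-*P-q h i)

xInvPow-cong : ∀ k {f g} → f ≈P g → xInvPow k f ≈P xInvPow k g
xInvPow-cong zero    f≈g   = f≈g
xInvPow-cong (suc k) f≈g i = xInvPow-cong k f≈g (suc i)

xInvPow-pointwise : ∀ k f i → xInvPow k f i ≡ f (k + i)
xInvPow-pointwise zero    f i = refl
xInvPow-pointwise (suc k) f i = trans (xInvPow-pointwise k f (suc i)) (cong f (ℕ.+-suc k i))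

xInvPow-shift-sub : ∀ k f → xInvPow (suc k) (shift f -P f) ≈P xInvPow k f -P xInvPow (suc k) f
xInvPow-shift-sub k f i = trans (xInvPow-pointwise (suc k) (shift f -P f) i)
  (sym (cong₂ _-ℤ_ (xInvPow-pointwise k f i) (xInvPow-pointwise (suc k) f i)))

X-1 : Poly
X-1 = X -P constP 1ℤ

X-1-*P : ∀ f → X-1 *P f ≈P shift f -P f
X-1-*P f i =
  trans (*P-distribʳ--P X (constP 1ℤ) f i) (cong₂ _-ℤ_ (X-*P f i) (*P-identityˡ f i))

X-1^-+ : ∀ a b → (X-1 ^P a) *P (X-1 ^P b) ≈P X-1 ^P (a + b)
X-1^-+ zero    b = *P-identityˡ (X-1 ^P b)
X-1^-+ (suc a) b = begin
    (X-1 *P X-1 ^P a) *P X-1 ^P b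
  ≈⟨ *P-congˡ (X-1 ^P b) (X-1-*P (X-1 ^P a)) ⟩
    (shift (X-1 ^P a) -P X-1 ^P a) *P X-1 ^P b
  ≈⟨ *P-distribʳ--P (shift (X-1 ^P a)) (X-1 ^P a) (X-1 ^P b) ⟩
    shift (X-1 ^P a) *P X-1 ^P b -P X-1 ^P a *P X-1 ^P b
  ≈⟨ -P-cong (shift-*P (X-1 ^P a) (X-1 ^P b)) (λ _ → refl) ⟩
    shift (X-1 ^P a *P X-1 ^P b) -P X-1 ^P a *P X-1 ^P b
  ≈⟨ -P-cong (shift-cong (X-1^-+ a b)) (X-1^-+ a b) ⟩
    shift (X-1 ^P (a + b)) -P X-1 ^P (a + b)
  ≈⟨ X-1-*P (X-1 ^P (a + b)) ⟨
    X-1 *P X-1 ^P (a + b)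
  ∎
  where open ≈P-Reasoning

p-suc : ∀ n → p (suc n) ≈P shift (X-1 ^P n)
p-suc n = X-*P (X-1 ^P n)

p-suc-suc : ∀ n → p (suc (suc n)) ≈P shift (p (suc n)) -P p (suc n)
p-suc-suc n = begin
    p (suc (suc n))                             ≈⟨ p-suc (suc n) ⟩
    shift (X-1 *P X-1 ^P n)                     ≈⟨ shift-cong (X-1-*P (X-1 ^P n)) ⟩
    shift (shift (X-1 ^P n) -P X-1 ^P n)        ≈⟨ shift--P (shift (X-1 ^P n)) (X-1 ^P n) ⟩
    shift (shift (X-1 ^P n)) -P shift (X-1 ^P n) ≈⟨ -P-cong (shift-cong (p-suc n)) (p-suc n) ⟨
    shift (p (suc n)) -P p (suc n)              ∎
  where open ≈P-Reasoning

p-*P-p : ∀ m n → p (suc m) *P p (suc n) ≈P X *P p (suc (m + n))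
p-*P-p m n = begin
    p (suc m) *P p (suc n)                  ≈⟨ *P-congˡ (p (suc n)) (p-suc m) ⟩
    shift (X-1 ^P m) *P p (suc n)           ≈⟨ shift-*P (X-1 ^P m) (p (suc n)) ⟩
    shift (X-1 ^P m *P p (suc n))           ≈⟨ shift-cong (*P-congʳ (X-1 ^P m) (p-suc n)) ⟩
    shift (X-1 ^P m *P shift (X-1 ^P n))    ≈⟨ shift-cong (*P-shift (X-1 ^P m) (X-1 ^P n)) ⟩
    shift (shift (X-1 ^P m *P X-1 ^P n))    ≈⟨ shift-cong (shift-cong (X-1^-+ m n)) ⟩
    shift (shift (X-1 ^P (m + n)))          ≈⟨ shift-cong (p-suc (m + n)) ⟨
    shift (p (suc (m + n)))                 ≈⟨ X-*P (p (suc (m + n))) ⟨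
    X *P p (suc (m + n))                    ∎
  where open ≈P-Reasoning

X-*P-p : ∀ n → X *P p (suc n) ≈P p (suc (suc n)) +P p (suc n)
X-*P-p n = begin
    X *P p (suc n)
  ≈⟨ X-*P (p (suc n)) ⟩
    shift (p (suc n))
  ≈⟨ (λ i → x-y+y≡x (shift (p (suc n)) i) (p (suc n) i)) ⟨
    (shift (p (suc n)) -P p (suc n)) +P p (suc n)
  ≈⟨ +P-cong (p-suc-suc n) (λ _ → refl) ⟨
    p (suc (suc n)) +P p (suc n)
  ∎
  where
  open ≈P-Reasoning
  x-y+y≡x : ∀ x y → (x -ℤ y) +ℤ y ≡ x
  x-y+y≡x = solve-∀

X^-*P-p : ∀ n k → (X ^P k) *P p (suc n) ≈P ΣP (suc k) (λ h → binom k h ·P p (suc n + h))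
X^-*P-p n k = begin
    X ^P k *P p (suc n)
  ≡⟨ cong (λ m → X ^P k *P p (suc m)) (ℕ.+-identityʳ n) ⟨
    X ^P k *P p (suc n + 0)
  ≈⟨ X^-*P-binomial (λ h → p (suc n + h)) X-*P-p[n+h] k ⟩
    ΣP (suc k) (λ h → binom k h ·P p (suc n + h))
  ∎
  where
  open ≈P-Reasoning
  X-*P-p[n+h] : ∀ h → X *P p (suc n + h) ≈P p (suc n + suc h) +P p (suc n + h)
  X-*P-p[n+h] h rewrite ℕ.+-suc n h = X-*P-p (n + h)

X-1^-alternating : ∀ n → X-1 ^P n ≈P ΣP (suc n) (λ h → (-1ℤ ^ (n ∸ h)) ·P p h)
X-1^-alternating zero    zero    = refl
X-1^-alternating zero    (suc i) = refl
X-1^-alternating (suc n) i       = begin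
    (X-1 *P X-1 ^P n) i
  ≡⟨ X-1-*P (X-1 ^P n) i ⟩
    shift (X-1 ^P n) i -ℤ (X-1 ^P n) i
  ≡⟨ cong₂ _-ℤ_ (sym (p-suc n i)) (trans (X-1^-alternating n i) (ΣP-pointwise (suc n) _ i)) ⟩
    p (suc n) i -ℤ sumℤ (suc n) (λ h → -1ℤ ^ (n ∸ h) * p h i)
  ≡⟨ cong (p (suc n) i +ℤ_) (sumℤ-neg (suc n) _) ⟨
    p (suc n) i +ℤ sumℤ (suc n) (λ h → - (-1ℤ ^ (n ∸ h) * p h i))
  ≡⟨ cong (p (suc n) i +ℤ_) (sumℤ-cong (suc n) flip) ⟩
    p (suc n) i +ℤ S
  ≡⟨ ℤ.+-comm (p (suc n) i) S ⟩
    S +ℤ p (suc n) i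
  ≡⟨ cong (S +ℤ_) (ℤ.*-identityˡ (p (suc n) i)) ⟨
    S +ℤ 1ℤ * p (suc n) i
  ≡⟨ cong (λ e → S +ℤ -1ℤ ^ e * p (suc n) i) (ℕ.n∸n≡0 n) ⟨
    S +ℤ -1ℤ ^ (n ∸ n) * p (suc n) i
  ≡⟨ ΣP-pointwise (suc (suc n)) _ i ⟨
    ΣP (suc (suc n)) (λ h → (-1ℤ ^ (suc n ∸ h)) ·P p h) i
  ∎
  where
  open ≡-Reasoning
  S : ℤ
  S = sumℤ (suc n) (λ h → -1ℤ ^ (suc n ∸ h) * p h i)
  flip : ∀ h → h < suc n → - (-1ℤ ^ (n ∸ h) * p h i) ≡ -1ℤ ^ (suc n ∸ h) * p h i
  flip h h<1+n = trans (ℤ.neg-distribˡ-* (-1ℤ ^ (n ∸ h)) (p h i))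
                       (cong (_* p h i) (sym (-1^-∸-suc h<1+n)))

xInv-p-alternating : ∀ n → xInv (p (suc n)) ≈P ΣP (suc n) (λ h → (-1ℤ ^ (suc n ∸ h ∸ 1)) ·P p h)
xInv-p-alternating n = begin
    xInv (p (suc n))                               ≈⟨ (λ i → p-suc n (suc i)) ⟩
    X-1 ^P n                                       ≈⟨ X-1^-alternating n ⟩
    ΣP (suc n) (λ h → (-1ℤ ^ (n ∸ h)) ·P p h)       ≈⟨ ΣP-cong (suc n) sign ⟩
    ΣP (suc n) (λ h → (-1ℤ ^ (suc n ∸ h ∸ 1)) ·P p h) ∎
  where
  open ≈P-Reasoning
  sign : ∀ h → h < suc n → (-1ℤ ^ (n ∸ h)) ·P p h ≈P (-1ℤ ^ (suc n ∸ h ∸ 1)) ·P p h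
  sign h _ i = cong (λ e → -1ℤ ^ e * p h i) (sym (m∸n∸o≡m∸o∸n (suc n) h 1))

xInvPow-p-signedBinom : ∀ k n →
  xInvPow (suc k) (p (suc n)) ≈P ΣP (suc n) (λ h → signedBinom (n ∸ h) k ·P p h)
xInvPow-p-signedBinom zero    n       i = begin
    p (suc n) (suc i)                                      ≡⟨ p-suc n (suc i) ⟩
    (X-1 ^P n) i                                           ≡⟨ X-1^-alternating n i ⟩
    ΣP (suc n) (λ h → (-1ℤ ^ (n ∸ h)) ·P p h) i             ≡⟨ ΣP-cong (suc n) times1 i ⟩
    ΣP (suc n) (λ h → signedBinom (n ∸ h) 0 ·P p h) i      ∎
  where
  open ≡-Reasoning
  times1 : ∀ h → h < suc n → (-1ℤ ^ (n ∸ h)) ·P p h ≈P signedBinom (n ∸ h) 0 ·P p h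
  times1 h _ j = cong (_* p h j) (sym (ℤ.*-identityʳ (-1ℤ ^ (n ∸ h))))
xInvPow-p-signedBinom (suc k) zero    i =
  -- x^{-(k+2)} annihilates p 1 = x
  trans (xInvPow-pointwise (suc (suc k)) (p 1) i)
        (trans (p-suc 0 (suc (suc (k + i)))) (sym (ΣP-one (λ h → signedBinom 0 (suc k) ·P p h) i)))
xInvPow-p-signedBinom (suc k) (suc n)   = begin
    xInvPow (suc (suc k)) (p (suc (suc n)))
  ≈⟨ xInvPow-cong (suc (suc k)) (p-suc-suc n) ⟩
    xInvPow (suc (suc k)) (shift (p (suc n)) -P p (suc n))
  ≈⟨ xInvPow-shift-sub (suc k) (p (suc n)) ⟩
    xInvPow (suc k) (p (suc n)) -P xInvPow (suc (suc k)) (p (suc n))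
  ≈⟨ -P-cong (xInvPow-p-signedBinom k n) (xInvPow-p-signedBinom (suc k) n) ⟩
    ΣP (suc n) (λ h → signedBinom (n ∸ h) k ·P p h)
      -P ΣP (suc n) (λ h → signedBinom (n ∸ h) (suc k) ·P p h)
  ≈⟨ ΣP-·P-sub (suc n) (λ h → signedBinom (n ∸ h) k) (λ h → signedBinom (n ∸ h) (suc k)) p ⟩
    ΣP (suc n) (λ h → (signedBinom (n ∸ h) k -ℤ signedBinom (n ∸ h) (suc k)) ·P p h)
  ≈⟨ ΣP-cong (suc n) pascal ⟩
    ΣP (suc n) (λ h → signedBinom (suc n ∸ h) (suc k) ·P p h)
  ≈⟨ drop-last ⟨
    ΣP (suc (suc n)) (λ h → signedBinom (suc n ∸ h) (suc k) ·P p h)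
  ∎
  where
  open ≈P-Reasoning
  pascal : ∀ h → h < suc n →
    (signedBinom (n ∸ h) k -ℤ signedBinom (n ∸ h) (suc k)) ·P p h
      ≈P signedBinom (suc n ∸ h) (suc k) ·P p h
  pascal h h<1+n j = cong (_* p h j) (trans (signedBinom-pascal (n ∸ h) k)
    (cong (λ r → signedBinom r (suc k)) (sym (ℕ.+-∸-assoc 1 (ℕ.≤-pred h<1+n)))))
  F : ℕ → Poly
  F h = signedBinom (suc n ∸ h) (suc k) ·P p h
  -- once n ∸ n is rewritten to 0, the last term computes to 0ℤ
  drop-last : ΣP (suc (suc n)) F ≈P ΣP (suc n) F
  drop-last j =
    trans (cong (λ r → ΣP (suc n) F j +ℤ signedBinom r (suc k) * p (suc n) j) (ℕ.n∸n≡0 n))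
          (ℤ.+-identityʳ (ΣP (suc n) F j))

xInvPow-p : ∀ k n → xInvPow (suc k) (p (suc n))
  ≈P ΣP (suc n ∸ k) (λ h → ((-1ℤ ^ (n ∸ k ∸ h)) * binom (n ∸ h) k) ·P p h)
xInvPow-p k n = begin
    xInvPow (suc k) (p (suc n))
  ≈⟨ xInvPow-p-signedBinom k n ⟩
    ΣP (suc n) (λ h → signedBinom (n ∸ h) k ·P p h)
  ≈⟨ ΣP-cong (suc n) (λ h _ j → cong (λ e → -1ℤ ^ e * binom (n ∸ h) k * p h j)
                                      (m∸n∸o≡m∸o∸n n h k)) ⟩
    ΣP (suc n) (λ h → ((-1ℤ ^ (n ∸ k ∸ h)) * binom (n ∸ h) k) ·P p h)
  ≈⟨ ΣP-trailing-zeros (suc n) _ (ℕ.m∸n≤m (suc n) k) vanish ⟩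
    ΣP (suc n ∸ k) (λ h → ((-1ℤ ^ (n ∸ k ∸ h)) * binom (n ∸ h) k) ·P p h)
  ∎
  where
  open ≈P-Reasoning
  vanish : ∀ h → suc n ∸ k ≤ h → h < suc n →
    ∀ j → (-1ℤ ^ (n ∸ k ∸ h) * binom (n ∸ h) k) * p h j ≡ 0ℤ
  vanish h 1+n∸k≤h h<1+n j = cong (_* p h j) (trans (cong (-1ℤ ^ (n ∸ k ∸ h) *_) binom≡0)
                                                    (ℤ.*-zeroʳ (-1ℤ ^ (n ∸ k ∸ h))))
    where
    binom≡0 : binom (n ∸ h) k ≡ 0ℤ
    binom≡0 = k>n⇒binom≡0 (1+n∸k≤h⇒n∸h<k {k = k} 1+n∸k≤h (ℕ.≤-pred h<1+n))

mainTheorem2 : (n m : ℕ) → 1 ≤ n → 1 ≤ m →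
    -- (1)
    (p n *P p m ≈P X *P p (n + m ∸ 1))
    -- (2)
    × ((k : ℕ) → (X ^P k) *P p n ≈P ΣP (suc k) (λ h → binom k h ·P p (n + h)))
    × (X *P p n ≈P p (suc n) +P p n)
    -- (3): the sum over h = 0 .. n-k has (n+1) ∸ k terms (empty if k > n)
    × ((k : ℕ) → 1 ≤ k →
        xInvPow k (p n) ≈P
          ΣP (suc n ∸ k) (λ h → ((-1ℤ ^ (n ∸ k ∸ h)) * binom (n ∸ 1 ∸ h) (k ∸ 1)) ·P p h))
    × (xInv (p n) ≈P ΣP n (λ h → (-1ℤ ^ (n ∸ h ∸ 1)) ·P p h))
mainTheorem2 (suc n) (suc m) _ _ =
    (λ i → trans (p-*P-p n m i) (cong (λ r → (X *P p r) i) (sym (ℕ.+-suc n m))))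
  , X^-*P-p n
  , X-*P-p n
  , (λ { (suc k) _ → xInvPow-p k n })
  , xInv-p-alternating n
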